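{- Let $k_1,k_2,k_3\in\mathbb{Z}_{\geq 0}$. Among the positive integer solutions $(x,y,z)$ of \[x^2+y^2+z^2+k_1xy+k_2yz+k_3zx=(3+k_1+k_2+k_3)xyz,\] the only ones in which two or more components are equal are $(1,1,1)$, $(k_2+2,1,1)$, $(1,k_3+2,1)$ and $(1,1,k_1+2)$. -}

module Defs where

open import Data.Nat using (ℕ; _+_; _*_)
open import Data.Product using (_×_)
open import Data.Sum using (_⊎_)
open import Relation.Binary.PropositionalEquality using (_≡_)

IsSolution : ℕ → ℕ → ℕ → ℕ → ℕ → ℕ → Set
IsSolution k₁ k₂ k₃ x y z =
  x * x + y * y + z * z + k₁ * x * y + k₂ * y * z + k₃ * z * x
    ≡ (3 + k₁ + k₂ + k₃) * x * y * z

TwoEqual : ℕ → ℕ → ℕ → Set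
TwoEqual x y z = x ≡ y ⊎ y ≡ z ⊎ z ≡ x

InList : ℕ → ℕ → ℕ → ℕ → ℕ → ℕ → Set
InList k₁ k₂ k₃ x y z =
  (x ≡ 1 × y ≡ 1 × z ≡ 1)
  ⊎ (x ≡ k₂ + 2 × y ≡ 1 × z ≡ 1)
  ⊎ (x ≡ 1 × y ≡ k₃ + 2 × z ≡ 1)
  ⊎ (x ≡ 1 × y ≡ 1 × z ≡ k₁ + 2)

{-# OPTIONS --safe #-}
-- Vieta jumping.  The equation is invariant under rotating (x, y, z) together with
-- (k₁, k₂, k₃), so it suffices to treat y = z.  Then x is a root of the quadratic
-- X² − ((b + c + 3)y² − cy)X + (b + 2)y²  (b = k₂, c = k₁ + k₃), whose other root x′
-- is a positive integer.  Comparing x + x′ ≤ x x′ + 1 with the Vieta relations forces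
-- y = 1, and then x + x′ = x x′ + 1 forces x = 1 or x′ = 1, i.e. x = b + 2.
module Submission where

open import Defs
open import Data.Nat using (ℕ; zero; suc; _+_; _*_; _∸_; _<_; _≤_; s≤s; >-nonZero)
open import Data.Nat.Properties
open import Algebra.Properties.CommutativeSemigroup +-commutativeSemigroup using (xy∙z≈xz∙y)
open import Data.Nat.Tactic.RingSolver using (solve-∀; solve)
open import Data.List using (_∷_; [])
open import Data.Product using (_×_; _,_; ∃-syntax)
open import Data.Sum using (_⊎_; inj₁; inj₂; map; map₂)
open import Function.Bundles using (_⇔_; mk⇔)
open import Relation.Binary.PropositionalEquality

sum-product-gap : ∀ m n → suc m * suc n + 1 ≡ suc m + suc n + m * n
sum-product-gap = solve-∀

m+n≤m*n+1 : ∀ {m n} → 0 < m → 0 < n → m + n ≤ m * n + 1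
m+n≤m*n+1 {suc m} {suc n} _ _ =
  subst (suc m + suc n ≤_) (sym (sum-product-gap m n)) (m≤m+n _ (m * n))

m+n≡m*n+1⇒m≡1∨n≡1 : ∀ {m n} → 0 < m → 0 < n → m + n ≡ m * n + 1 → m ≡ 1 ⊎ n ≡ 1
m+n≡m*n+1⇒m≡1∨n≡1 {suc m} {suc n} _ _ eq =
  map (cong suc) (cong suc) (m*n≡0⇒m≡0∨n≡0 m mn≡0)
  where
  mn≡0 : m * n ≡ 0
  mn≡0 = sym (+-cancelˡ-≡ (suc m + suc n) 0 (m * n)
           (trans (+-identityʳ _) (trans eq (sum-product-gap m n))))

n*n≤1⇒n≡1 : ∀ {n} → 0 < n → n * n ≤ 1 → n ≡ 1
n*n≤1⇒n≡1 {suc zero}    _ _             = refl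
n*n≤1⇒n≡1 {suc (suc n)} _ (s≤s ())

x*s+p≡x*t⇒x*[t∸s]≡p : ∀ x s t p → x * s + p ≡ x * t → x * (t ∸ s) ≡ p
x*s+p≡x*t⇒x*[t∸s]≡p x s t p eq = begin
  x * (t ∸ s)         ≡⟨ *-distribˡ-∸ x t s ⟩
  x * t ∸ x * s       ≡⟨ cong (_∸ x * s) (sym eq) ⟩
  x * s + p ∸ x * s   ≡⟨ m+n∸m≡n (x * s) p ⟩
  p                   ∎
  where open ≡-Reasoning

other-root : ∀ b c {x y} → 0 < y →
  x * (x + c * y) + (2 + b) * (y * y) ≡ x * ((3 + b + c) * (y * y)) →
  ∃[ x′ ] 0 < x′ × x + x′ + c * y ≡ x * x′ + y * y + c * (y * y)
              × x * x′ ≡ (2 + b) * (y * y)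
other-root b c {x} {y@(suc w)} _ eq = x′ , n≢0⇒n>0 x′≢0 , vieta-sum , vieta-product
  where
  open ≡-Reasoning
  t : ℕ
  t = (3 + b + c) * (y * y)

  x′ : ℕ
  x′ = t ∸ (x + c * y)

  vieta-product : x * x′ ≡ (2 + b) * (y * y)
  vieta-product = x*s+p≡x*t⇒x*[t∸s]≡p x (x + c * y) t _ eq

  -- (2 + b) * (y * y) reduces to a successor since y = suc w.
  x′≢0 : x′ ≢ 0
  x′≢0 x′≡0 = 0≢1+n (begin
    0                   ≡⟨ sym (*-zeroʳ x) ⟩
    x * 0               ≡⟨ cong (x *_) (sym x′≡0) ⟩
    x * x′              ≡⟨ vieta-product ⟩
    (2 + b) * (y * y)   ∎)

  vieta-sum : x + x′ + c * y ≡ x * x′ + y * y + c * (y * y)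
  vieta-sum = begin
    x + x′ + c * y                    ≡⟨ xy∙z≈xz∙y x x′ (c * y) ⟩
    x + c * y + x′                    ≡⟨ m+[n∸m]≡n {x + c * y} {t} (<⇒≤ (m∸n≢0⇒n<m x′≢0)) ⟩
    (3 + b + c) * (y * y)             ≡⟨ solve (b ∷ c ∷ w ∷ []) ⟩
    (2 + b) * (y * y) + y * y + c * (y * y)
                                      ≡⟨ cong (λ p → p + y * y + c * (y * y)) vieta-product ⟨
    x * x′ + y * y + c * (y * y)      ∎

vieta-bound : ∀ c {x x′ y} → 0 < x → 0 < x′ → 0 < y →
  x + x′ + c * y ≡ x * x′ + y * y + c * (y * y) → y * y ≤ 1
vieta-bound c {x} {x′} {y} 0<x 0<x′ 0<y vieta-sum =
  +-cancelˡ-≤ (x * x′) (y * y) 1 (+-cancelʳ-≤ (c * (y * y)) _ _ (begin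
    x * x′ + y * y + c * (y * y)   ≡⟨ vieta-sum ⟨
    x + x′ + c * y                 ≤⟨ +-mono-≤ (m+n≤m*n+1 0<x 0<x′) (*-monoʳ-≤ c y≤y*y) ⟩
    x * x′ + 1 + c * (y * y)       ∎))
  where
  open ≤-Reasoning
  y≤y*y : y ≤ y * y
  y≤y*y = m≤m*n y y {{>-nonZero 0<y}}

repeated-solutions : ∀ b c {x y} → 0 < x → 0 < y →
  x * (x + c * y) + (2 + b) * (y * y) ≡ x * ((3 + b + c) * (y * y)) →
  y ≡ 1 × (x ≡ 1 ⊎ x ≡ b + 2)
repeated-solutions b c {x} 0<x 0<y eq with other-root b c 0<y eq
... | x′ , 0<x′ , vieta-sum , vieta-product
    with refl ← n*n≤1⇒n≡1 0<y (vieta-bound c 0<x 0<x′ 0<y vieta-sum) =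
  refl , map₂ x′≡1⇒x≡b+2 (m+n≡m*n+1⇒m≡1∨n≡1 0<x 0<x′ (+-cancelʳ-≡ (c * 1) _ _ vieta-sum))
  where
  x′≡1⇒x≡b+2 : x′ ≡ 1 → x ≡ b + 2
  x′≡1⇒x≡b+2 refl = trans (sym (*-identityʳ x))
                      (trans vieta-product (trans (*-identityʳ (2 + b)) (+-comm 2 b)))

IsSolution-rotate : ∀ k₁ k₂ k₃ x y z → IsSolution k₁ k₂ k₃ x y z → IsSolution k₂ k₃ k₁ y z x
IsSolution-rotate k₁ k₂ k₃ x y z sol = begin
  y * y + z * z + x * x + k₂ * y * z + k₃ * z * x + k₁ * x * y
    ≡⟨ solve (k₁ ∷ k₂ ∷ k₃ ∷ x ∷ y ∷ z ∷ []) ⟩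
  x * x + y * y + z * z + k₁ * x * y + k₂ * y * z + k₃ * z * x
    ≡⟨ sol ⟩
  (3 + k₁ + k₂ + k₃) * x * y * z
    ≡⟨ solve (k₁ ∷ k₂ ∷ k₃ ∷ x ∷ y ∷ z ∷ []) ⟩
  (3 + k₂ + k₃ + k₁) * y * z * x
    ∎
  where open ≡-Reasoning

InList-unrotate : ∀ {k₁ k₂ k₃ x y z} → InList k₂ k₃ k₁ y z x → InList k₁ k₂ k₃ x y z
InList-unrotate (inj₁ (y≡1 , z≡1 , x≡1))                 = inj₁ (x≡1 , y≡1 , z≡1)
InList-unrotate (inj₂ (inj₁ (y≡k₃+2 , z≡1 , x≡1)))       = inj₂ (inj₂ (inj₁ (x≡1 , y≡k₃+2 , z≡1)))
InList-unrotate (inj₂ (inj₂ (inj₁ (y≡1 , z≡k₁+2 , x≡1)))) = inj₂ (inj₂ (inj₂ (x≡1 , y≡1 , z≡k₁+2)))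
InList-unrotate (inj₂ (inj₂ (inj₂ (y≡1 , z≡1 , x≡k₂+2)))) = inj₂ (inj₁ (x≡k₂+2 , y≡1 , z≡1))

IsSolution-repeated : ∀ k₁ k₂ k₃ x y → IsSolution k₁ k₂ k₃ x y y →
  x * (x + (k₁ + k₃) * y) + (2 + k₂) * (y * y) ≡ x * ((3 + k₂ + (k₁ + k₃)) * (y * y))
IsSolution-repeated k₁ k₂ k₃ x y sol = begin
  x * (x + (k₁ + k₃) * y) + (2 + k₂) * (y * y)
    ≡⟨ solve (k₁ ∷ k₂ ∷ k₃ ∷ x ∷ y ∷ []) ⟩
  x * x + y * y + y * y + k₁ * x * y + k₂ * y * y + k₃ * y * x
    ≡⟨ sol ⟩
  (3 + k₁ + k₂ + k₃) * x * y * y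
    ≡⟨ solve (k₁ ∷ k₂ ∷ k₃ ∷ x ∷ y ∷ []) ⟩
  x * ((3 + k₂ + (k₁ + k₃)) * (y * y))
    ∎
  where open ≡-Reasoning

IsSolution-repeated⇒InList : ∀ k₁ k₂ k₃ {x y} → 0 < x → 0 < y →
  IsSolution k₁ k₂ k₃ x y y → InList k₁ k₂ k₃ x y y
IsSolution-repeated⇒InList k₁ k₂ k₃ {x} {y} 0<x 0<y sol
  with repeated-solutions k₂ (k₁ + k₃) 0<x 0<y (IsSolution-repeated k₁ k₂ k₃ x y sol)
... | refl , inj₁ refl = inj₁ (refl , refl , refl)
... | refl , inj₂ refl = inj₂ (inj₁ (refl , refl , refl))

InList⇒IsSolution : ∀ {k₁ k₂ k₃ x y z} → InList k₁ k₂ k₃ x y z → IsSolution k₁ k₂ k₃ x y z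
InList⇒IsSolution {k₁} {k₂} {k₃} (inj₁ (refl , refl , refl))                = solve (k₁ ∷ k₂ ∷ k₃ ∷ [])
InList⇒IsSolution {k₁} {k₂} {k₃} (inj₂ (inj₁ (refl , refl , refl)))        = solve (k₁ ∷ k₂ ∷ k₃ ∷ [])
InList⇒IsSolution {k₁} {k₂} {k₃} (inj₂ (inj₂ (inj₁ (refl , refl , refl)))) = solve (k₁ ∷ k₂ ∷ k₃ ∷ [])
InList⇒IsSolution {k₁} {k₂} {k₃} (inj₂ (inj₂ (inj₂ (refl , refl , refl)))) = solve (k₁ ∷ k₂ ∷ k₃ ∷ [])

InList⇒TwoEqual : ∀ {k₁ k₂ k₃ x y z} → InList k₁ k₂ k₃ x y z → TwoEqual x y z
InList⇒TwoEqual (inj₁ (refl , refl , refl))                = inj₁ refl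
InList⇒TwoEqual (inj₂ (inj₁ (_ , refl , refl)))            = inj₂ (inj₁ refl)
InList⇒TwoEqual (inj₂ (inj₂ (inj₁ (refl , _ , refl))))     = inj₂ (inj₂ refl)
InList⇒TwoEqual (inj₂ (inj₂ (inj₂ (refl , refl , _))))     = inj₁ refl

lemma2p2 : (k₁ k₂ k₃ x y z : ℕ) → 0 < x → 0 < y → 0 < z →
    (IsSolution k₁ k₂ k₃ x y z × TwoEqual x y z) ⇔ InList k₁ k₂ k₃ x y z
lemma2p2 k₁ k₂ k₃ x y z 0<x 0<y 0<z =
  mk⇔ (λ (sol , twoEqual) → classify sol twoEqual) (λ l → InList⇒IsSolution l , InList⇒TwoEqual l)
  where
  classify : IsSolution k₁ k₂ k₃ x y z → TwoEqual x y z → InList k₁ k₂ k₃ x y z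
  classify sol (inj₂ (inj₁ refl)) = IsSolution-repeated⇒InList k₁ k₂ k₃ 0<x 0<y sol
  classify sol (inj₂ (inj₂ refl)) = InList-unrotate
    (IsSolution-repeated⇒InList k₂ k₃ k₁ 0<y 0<z (IsSolution-rotate k₁ k₂ k₃ x y x sol))
  classify sol (inj₁ refl)        = InList-unrotate (InList-unrotate
    (IsSolution-repeated⇒InList k₃ k₁ k₂ 0<z 0<x
      (IsSolution-rotate k₂ k₃ k₁ x z x (IsSolution-rotate k₁ k₂ k₃ x x z sol))))
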